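{- Let $\Sigma'$ be the first-order theory in the language $\{+,\cdot,0,1,<\}$ axiomatized by A1–A21 (described in the context). Then $\Sigma'$ proves the following sentence $\mathbf{GS}^s$: for every prime $p$ there exists an element $n$ such that (i) every $t$ with $1<t<n$, $t$ relatively prime to $n$, and $v$ relatively prime to $t$ for every prime $v\le p$, is prime (i.e. $n$ is $p$-good), and (ii) for every $m$ with $n<m$ there exists $q$ with $1<q<m$, $q$ relatively prime to $m$, $u$ relatively prime to $q$ for every prime $u\le p$, and $q$ not prime (i.e. no $m>n$ is $p$-good).
   Context: Language $\{+,\cdot,0,1,<\}$. Axioms A1–A15 (universal closures; together the theory $\mathrm{PA}^-$, whose models are the nonnegative parts of discretely ordered commutative rings): A1 $(x+y)+z=x+(y+z)$; A2 $x+y=y+x$; A3 $(xy)z=x(yz)$; A4 $xy=yx$; A5 $x(y+z)=xy+xz$; A6 $x+0=x\wedge x\cdot 0=0$; A7 $x\cdot1=x$; A8 $x<y\wedge y<z\to x<z$; A9 $\neg x<x$; A10 $x<y\vee x=y\vee y<x$; A11 $x<y\to x+z<y+z$; A12 $0<z\wedge x<y\to xz<yz$; A13 $x<y\to\exists z\,(x+z=y)$; A14 $0<1\wedge(x>0\to x\ge 1)$; A15 $x>0\vee x=0$. Notation: $\bar k$ denotes the numeral $1+\dots+1$ ($k$ ones); $x\le y$ means $x<y\vee x=y$; $x\mid y$ means $\exists z\,(xz=y)$; $m,n$ are relatively prime if every common divisor of $m$ and $n$ equals $1$; $x$ is prime means $1<x$ and for all $a,b,c$, if $xc=ab$ then $x\mid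 a$ or $x\mid b$. Primes $a<b$ are consecutive if $b\le u$ for every prime $u>a$. A16: every prime $p$ has a prime $q>p$ with $q\le u$ for every prime $u>p$. A17: every prime $p>\bar2$ has a prime $q<p$ with $u\le q$ for every prime $u<p$. A18: for every $n>\bar4$ there is a prime $p$ with $p^2<n$ such that $n\le q^2$ for every prime $q>p$. A19: for all primes $r<p<q$ with $r,p$ consecutive, $p,q$ consecutive and $\overline{17}<q$: $q^2<\bar2pr$. A20: every $n>1$ has a prime divisor. A21: for all consecutive primes $p<q$ there is $k$ with $kp<q^2$ and $(k+1)p>q^2$. -}

module Defs where

open import Data.Nat using (ℕ; zero; suc)
open import Data.Product using (Σ; _×_; _,_)
open import Data.Sum using (_⊎_)
open import Relation.Nullary using (¬_)
open import Relation.Binary.PropositionalEquality using (_≡_)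

record Structure : Set₁ where
  infixl 6 _+_
  infixl 7 _·_
  infix 4 _<_
  field
    M   : Set
    _+_ : M → M → M
    _·_ : M → M → M
    0#  : M
    1#  : M
    _<_ : M → M → Set

module Notions (S : Structure) where
  open Structure S

  infix 4 _≤_ _∣_

  _≤_ : M → M → Set
  x ≤ y = (x < y) ⊎ (x ≡ y)

  num : ℕ → M
  num zero = 0#
  num (suc zero) = 1#
  num (suc (suc k)) = num (suc k) + 1#

  _∣_ : M → M → Set
  x ∣ y = Σ M (λ z → x · z ≡ y)

  RelPrime : M → M → Set
  RelPrime m n = ∀ d → d ∣ m → d ∣ n → d ≡ 1#

  Prime : M → Set
  Prime x = (1# < x) × (∀ a b c → x · c ≡ a · b → (x ∣ a) ⊎ (x ∣ b))

  Consecutive : M → M → Set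
  Consecutive a b = Prime a × Prime b × (a < b) × (∀ u → Prime u → a < u → b ≤ u)

  Good : M → M → Set
  Good p n = ∀ t → 1# < t → t < n → RelPrime t n
             → (∀ v → Prime v → v ≤ p → RelPrime v t) → Prime t

  GSs : Set
  GSs = ∀ p → Prime p →
        Σ M (λ n → Good p n ×
          (∀ m → n < m →
             Σ M (λ q → (1# < q) × (q < m) × RelPrime q m
                        × (∀ u → Prime u → u ≤ p → RelPrime u q)
                        × ¬ Prime q)))

record IsΣ' (S : Structure) : Set where
  open Structure S
  open Notions S
  field
    A1  : ∀ x y z → (x + y) + z ≡ x + (y + z)
    A2  : ∀ x y → x + y ≡ y + x
    A3  : ∀ x y z → (x · y) · z ≡ x · (y · z)
    A4  : ∀ x y → x · y ≡ y · x
    A5  : ∀ x y z → x · (y + z) ≡ x · y + x · z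
    A6  : ∀ x → (x + 0# ≡ x) × (x · 0# ≡ 0#)
    A7  : ∀ x → x · 1# ≡ x
    A8  : ∀ x y z → x < y → y < z → x < z
    A9  : ∀ x → ¬ (x < x)
    A10 : ∀ x y → (x < y) ⊎ (x ≡ y) ⊎ (y < x)
    A11 : ∀ x y z → x < y → x + z < y + z
    A12 : ∀ x y z → 0# < z → x < y → x · z < y · z
    A13 : ∀ x y → x < y → Σ M (λ z → x + z ≡ y)
    A14 : (0# < 1#) × (∀ x → 0# < x → 1# ≤ x)
    A15 : ∀ x → (0# < x) ⊎ (x ≡ 0#)
    A16 : ∀ p → Prime p →
          Σ M (λ q → Prime q × (p < q) × (∀ u → Prime u → p < u → q ≤ u))
    A17 : ∀ p → Prime p → num 2 < p →
          Σ M (λ q → Prime q × (q < p) × (∀ u → Prime u → u < p → u ≤ q))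
    A18 : ∀ n → num 4 < n →
          Σ M (λ p → Prime p × (p · p < n) × (∀ q → Prime q → p < q → n ≤ q · q))
    A19 : ∀ r p q → Prime r → Prime p → Prime q → r < p → p < q →
          Consecutive r p → Consecutive p q → num 17 < q →
          q · q < num 2 · p · r
    A20 : ∀ n → 1# < n → Σ M (λ p → Prime p × (p ∣ n))
    A21 : ∀ p q → Consecutive p q →
          Σ M (λ k → (k · p < q · q) × (q · q < (k + 1#) · p))

LEM : Set₁
LEM = (P : Set) → P ⊎ ¬ P

-- Call n saturated (for the prime p) when every prime w > p with w² < n divides
-- n. Saturated numbers are p-good: a composite t < n coprime to n and to every
-- prime ≤ p has a prime factor w > p with w² ≤ t < n, and w would divide n. If n
-- is not saturated, a witness w (found by excluded middle) makes w² a composite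
-- showing that n is not p-good. So it suffices to find a largest saturated number.
--
-- Let p < p₁ < p₂ be consecutive primes and m > 4 saturated, with P² < m ≤ Q² for
-- consecutive primes P < Q (A18). If P < p₂ then m ≤ p₂². Otherwise P and its
-- predecessor R both divide m, so once Q > 17, A19 (Q² < 2PR) forces m = PR; the
-- predecessor of R would divide m as well unless R ≤ p₁, hence m = PR ≤ p₂². For
-- p > 17 this bounds every saturated m by p₂²; such m > p₁² are multiples of p₁,
-- so the largest one is kp₁ with k from A21. For p ≤ 17 every saturated number is
-- at most 23², and a finite search in ℕ finds the largest one.
module Submission where

open import Defs

open import Data.Nat as ℕ using (ℕ; zero; suc; z≤n; s≤s)
import Data.Nat.Properties as ℕₚ
open ℕₚ using (allUpTo?)
open import Data.Nat.Divisibility using (divides; _∣?_) renaming (_∣_ to _∣ℕ_)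
open import Data.Nat.Primality using (Irreducible; prime?; prime⇒nonTrivial; prime⇒irreducible; irreducible⇒prime)
  renaming (Prime to Primeℕ)
open import Data.Product using (Σ; _×_; _,_; proj₁; proj₂; map₂)
open import Data.Sum using (_⊎_; inj₁; inj₂; [_,_]′; reduce) renaming (map to ⊎-map)
open import Data.Empty using (⊥; ⊥-elim)
open import Function using (_∘_)
open import Relation.Nullary using (¬_; ¬?; Dec)
open import Relation.Nullary.Negation using (Stable)
open import Relation.Nullary.Decidable using (from-yes; fromSum; decidable-stable; _×-dec_; _→-dec_)
open import Relation.Binary.PropositionalEquality
  using (_≡_; _≢_; refl; sym; trans; cong; cong₂; subst; subst₂; module ≡-Reasoning)

SaturatedBelow : ℕ → ℕ → ℕ → Set
SaturatedBelow b p n = ∀ {w} → w ℕ.< b → Primeℕ w → p ℕ.< w → w ℕ.* w ℕ.< n → w ∣ℕ n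

saturatedBelow? : ∀ b p n → Dec (SaturatedBelow b p n)
saturatedBelow? b p n = allUpTo? (λ w → prime? w →-dec p ℕ.<? w →-dec w ℕ.* w ℕ.<? n →-dec w ∣? n) b

-- The largest p-good number for the primes p ≤ 17, where kp₁ is not the answer
-- (for p = 7 it is 2·11·13, not 15·11); other arguments are junk.
largestGood : ℕ → ℕ
largestGood 2  = 105
largestGood 3  = 105
largestGood 5  = 154
largestGood 7  = 286
largestGood 11 = 286
largestGood 13 = 357
largestGood 17 = 513
largestGood _  = 0

abstract
  largestGood-saturated : ∀ {p} → p ℕ.< 18 → Primeℕ p →
    4 ℕ.< largestGood p × largestGood p ℕ.< 530 × SaturatedBelow 23 p (largestGood p)
  largestGood-saturated = from-yes (allUpTo? (λ p → prime? p →-dec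
    4 ℕ.<? largestGood p ×-dec largestGood p ℕ.<? 530 ×-dec saturatedBelow? 23 p (largestGood p)) 18)

  above-largestGood-unsaturated : ∀ {p} → p ℕ.< 18 → Primeℕ p →
    ∀ {m} → m ℕ.< 530 → largestGood p ℕ.< m → ¬ SaturatedBelow 23 p m
  above-largestGood-unsaturated = from-yes (allUpTo? (λ p → prime? p →-dec
    allUpTo? (λ m → largestGood p ℕ.<? m →-dec ¬? (saturatedBelow? 23 p m)) 530) 18)

stable : LEM → (P : Set) → Stable P
stable lem P = decidable-stable (fromSum (lem P))

module Model (S : Structure) (ax : IsΣ' S) where
  open Structure S
  open Notions S
  open IsΣ' ax

  variable
    d m n p p₁ p₂ q r t u w x y z : M

  <-trans : x < y → y < z → x < z
  <-trans = A8 _ _ _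

  ≤-<-trans : x ≤ y → y < z → x < z
  ≤-<-trans (inj₁ x<y) y<z = <-trans x<y y<z
  ≤-<-trans (inj₂ refl) y<z = y<z

  <-≤-trans : x < y → y ≤ z → x < z
  <-≤-trans x<y (inj₁ y<z) = <-trans x<y y<z
  <-≤-trans x<y (inj₂ refl) = x<y

  ≤-trans : x ≤ y → y ≤ z → x ≤ z
  ≤-trans (inj₁ x<y) y≤z = inj₁ (<-≤-trans x<y y≤z)
  ≤-trans (inj₂ refl) y≤z = y≤z

  ≤-refl : x ≤ x
  ≤-refl = inj₂ refl

  <⇒≢ : x < y → x ≢ y
  <⇒≢ x<x refl = A9 _ x<x

  <⇒≱ : x < y → ¬ y ≤ x
  <⇒≱ x<y y≤x = A9 _ (<-≤-trans x<y y≤x)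

  ≤-antisym : x ≤ y → y ≤ x → x ≡ y
  ≤-antisym (inj₁ x<y) y≤x = ⊥-elim (<⇒≱ x<y y≤x)
  ≤-antisym (inj₂ x≡y) _ = x≡y

  ≤∨> : ∀ x y → x ≤ y ⊎ y < x
  ≤∨> x y with A10 x y
  ... | inj₁ x<y = inj₁ (inj₁ x<y)
  ... | inj₂ (inj₁ x≡y) = inj₁ (inj₂ x≡y)
  ... | inj₂ (inj₂ y<x) = inj₂ y<x

  +-identityʳ : ∀ x → x + 0# ≡ x
  +-identityʳ x = proj₁ (A6 x)

  +-identityˡ : ∀ x → 0# + x ≡ x
  +-identityˡ x = trans (A2 0# x) (+-identityʳ x)

  zeroʳ : ∀ x → x · 0# ≡ 0#
  zeroʳ x = proj₂ (A6 x)

  zeroˡ : ∀ x → 0# · x ≡ 0#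
  zeroˡ x = trans (A4 0# x) (zeroʳ x)

  ·-identityˡ : ∀ x → 1# · x ≡ x
  ·-identityˡ x = trans (A4 1# x) (A7 x)

  0<1 : 0# < 1#
  0<1 = proj₁ A14

  0<⇒1≤ : 0# < x → 1# ≤ x
  0<⇒1≤ = proj₂ A14 _

  0≤ : 0# ≤ x
  0≤ {x = x} = [ inj₁ , inj₂ ∘ sym ]′ (A15 x)

  +-monoʳ-< : y < z → x + y < x + z
  +-monoʳ-< {y = y} {z = z} {x = x} y<z = subst₂ _<_ (A2 y x) (A2 z x) (A11 y z x y<z)

  x<x+1 : x < x + 1#
  x<x+1 {x = x} = subst (_< x + 1#) (+-identityʳ x) (+-monoʳ-< 0<1)

  <⇒+1≤ : x < y → x + 1# ≤ y
  <⇒+1≤ {x = x} {y = y} x<y with A13 x y x<y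
  ... | z , x+z≡y with A15 z
  ... | inj₂ refl = ⊥-elim (<⇒≢ x<y (trans (sym (+-identityʳ x)) x+z≡y))
  ... | inj₁ 0<z with 0<⇒1≤ 0<z
  ... | inj₁ 1<z = inj₁ (subst (x + 1# <_) x+z≡y (+-monoʳ-< 1<z))
  ... | inj₂ refl = inj₂ x+z≡y

  <+1⇒≤ : x < y + 1# → x ≤ y
  <+1⇒≤ {x = x} {y = y} x<y+1 with ≤∨> x y
  ... | inj₁ x≤y = x≤y
  ... | inj₂ y<x = ⊥-elim (<⇒≱ x<y+1 (<⇒+1≤ y<x))

  ·-monoˡ-≤ : x ≤ y → x · z ≤ y · z
  ·-monoˡ-≤ {x = x} {y = y} {z = z} x≤y with A15 z | x≤y
  ... | inj₂ refl | _ = inj₂ (trans (zeroʳ x) (sym (zeroʳ y)))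
  ... | inj₁ 0<z | inj₁ x<y = inj₁ (A12 x y z 0<z x<y)
  ... | inj₁ _ | inj₂ refl = ≤-refl

  ·-monoʳ-≤ : x ≤ y → z · x ≤ z · y
  ·-monoʳ-≤ {x = x} {y = y} {z = z} x≤y = subst₂ _≤_ (A4 x z) (A4 y z) (·-monoˡ-≤ x≤y)

  ·-mono-≤ : x ≤ y → z ≤ t → x · z ≤ y · t
  ·-mono-≤ x≤y z≤t = ≤-trans (·-monoˡ-≤ x≤y) (·-monoʳ-≤ z≤t)

  ·-monoʳ-< : 0# < z → x < y → z · x < z · y
  ·-monoʳ-< {z = z} {x = x} {y = y} 0<z x<y = subst₂ _<_ (A4 x z) (A4 y z) (A12 x y z 0<z x<y)

  ·-cancelʳ-< : x · z < y · z → x < y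
  ·-cancelʳ-< {x = x} {y = y} xz<yz with ≤∨> y x
  ... | inj₁ y≤x = ⊥-elim (<⇒≱ xz<yz (·-monoˡ-≤ y≤x))
  ... | inj₂ x<y = x<y

  ·-cancelˡ-< : z · x < z · y → x < y
  ·-cancelˡ-< {z = z} {x = x} {y = y} = ·-cancelʳ-< ∘ subst₂ _<_ (A4 z x) (A4 z y)

  ·-cancelˡ-≡ : 0# < z → z · x ≡ z · y → x ≡ y
  ·-cancelˡ-≡ {z = z} {x = x} {y = y} 0<z zx≡zy with A10 x y
  ... | inj₁ x<y = ⊥-elim (<⇒≢ (·-monoʳ-< 0<z x<y) zx≡zy)
  ... | inj₂ (inj₁ x≡y) = x≡y
  ... | inj₂ (inj₂ y<x) = ⊥-elim (<⇒≢ (·-monoʳ-< 0<z y<x) (sym zx≡zy))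

  square-≤ : x ≤ y → x · x ≤ y · y
  square-≤ x≤y = ·-mono-≤ x≤y x≤y

  square-< : x < y → x · x < y · y
  square-< {x = x} {y = y} x<y = ≤-<-trans (·-monoʳ-≤ (inj₁ x<y)) (A12 x y y (≤-<-trans 0≤ x<y) x<y)

  square-cancel-< : x · x < y · y → x < y
  square-cancel-< {x = x} {y = y} xx<yy with ≤∨> y x
  ... | inj₁ y≤x = ⊥-elim (<⇒≱ xx<yy (square-≤ y≤x))
  ... | inj₂ x<y = x<y

  x<x·x : 1# < x → x < x · x
  x<x·x {x = x} 1<x = subst (_< x · x) (·-identityˡ x) (A12 1# x x (<-trans 0<1 1<x) 1<x)

  ∣-refl : x ∣ x
  ∣-refl {x = x} = 1# , A7 x

  ∣-trans : x ∣ y → y ∣ z → x ∣ z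
  ∣-trans {x = x} (a , xa≡y) (b , yb≡z) = a · b , trans (sym (A3 x a b)) (trans (cong (_· b) xa≡y) yb≡z)

  n∣m·n : ∀ {a b} → b ∣ a · b
  n∣m·n {a} {b} = a , A4 b a

  ∣-quotient : (x∣y : x ∣ y) → proj₁ x∣y ∣ y
  ∣-quotient {x = x} (z , xz≡y) = x , trans (A4 z x) xz≡y

  ∣⇒0< : 0# < y → x ∣ y → 0# < x
  ∣⇒0< {x = x} 0<y (z , xz≡y) with A15 x
  ... | inj₁ 0<x = 0<x
  ... | inj₂ refl = ⊥-elim (<⇒≢ 0<y (trans (sym (zeroˡ z)) xz≡y))

  ∣⇒≤ : 0# < y → x ∣ y → x ≤ y
  ∣⇒≤ {x = x} 0<y x∣y@(z , xz≡y) =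
    subst₂ _≤_ (A7 x) xz≡y (·-monoʳ-≤ (0<⇒1≤ (∣⇒0< 0<y (∣-quotient x∣y))))

  ∣1⇒≡1 : x ∣ 1# → x ≡ 1#
  ∣1⇒≡1 x∣1 = ≤-antisym (∣⇒≤ 0<1 x∣1) (0<⇒1≤ (∣⇒0< 0<1 x∣1))

  prime⇒1< : Prime p → 1# < p
  prime⇒1< = proj₁

  prime⇒0< : Prime p → 0# < p
  prime⇒0< pp = <-trans 0<1 (prime⇒1< pp)

  prime⇒2≤ : Prime p → num 2 ≤ p
  prime⇒2≤ = <⇒+1≤ ∘ prime⇒1<

  prime≢1 : Prime p → p ≢ 1#
  prime≢1 pp = <⇒≢ (prime⇒1< pp) ∘ sym

  prime-divisors : Prime p → d ∣ p → d ≡ 1# ⊎ d ≡ p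
  prime-divisors {p = p} {d = d} pp d∣p@(e , de≡p) with proj₂ pp d e 1# (trans (A7 p) (sym de≡p))
  ... | inj₁ p∣d =
    inj₂ (≤-antisym (∣⇒≤ (prime⇒0< pp) d∣p) (∣⇒≤ (∣⇒0< (prime⇒0< pp) d∣p) p∣d))
  ... | inj₂ (f , pf≡e) = inj₁ (∣1⇒≡1 (f , ·-cancelˡ-≡ (prime⇒0< pp) p·df≡p·1))
    where
    open ≡-Reasoning
    p·df≡p·1 : p · (d · f) ≡ p · 1#
    p·df≡p·1 = begin
      p · (d · f)  ≡⟨ sym (A3 p d f) ⟩
      (p · d) · f  ≡⟨ cong (_· f) (A4 p d) ⟩
      (d · p) · f  ≡⟨ A3 d p f ⟩
      d · (p · f)  ≡⟨ cong (d ·_) pf≡e ⟩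
      d · e        ≡⟨ de≡p ⟩
      p            ≡⟨ sym (A7 p) ⟩
      p · 1#       ∎

  prime∣prime⇒≡ : Prime u → Prime w → u ∣ w → u ≡ w
  prime∣prime⇒≡ pu pw u∣w = [ ⊥-elim ∘ prime≢1 pu , (λ u≡w → u≡w) ]′ (prime-divisors pw u∣w)

  prime∣·⇒≡ : Prime u → Prime x → Prime y → u ∣ x · y → u ≡ x ⊎ u ≡ y
  prime∣·⇒≡ pu px py (c , uc≡xy) =
    ⊎-map (prime∣prime⇒≡ pu px) (prime∣prime⇒≡ pu py) (proj₂ pu _ _ c uc≡xy)

  distinct-primes⇒·∣ : Prime x → Prime y → x ≢ y → x ∣ m → y ∣ m → x · y ∣ m
  distinct-primes⇒·∣ {x = x} {y = y} {m = m} px py x≢y (a , xa≡m) (b , yb≡m)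
    with proj₂ py x a b (trans yb≡m (sym xa≡m))
  ... | inj₁ y∣x = ⊥-elim (x≢y (sym (prime∣prime⇒≡ py px y∣x)))
  ... | inj₂ (c , yc≡a) = c , (begin
      (x · y) · c  ≡⟨ A3 x y c ⟩
      x · (y · c)  ≡⟨ cong (x ·_) yc≡a ⟩
      x · a        ≡⟨ xa≡m ⟩
      m            ∎)
    where open ≡-Reasoning

  ∣∧<2·⇒≡ : 0# < m → d ∣ m → m < num 2 · d → m ≡ d
  ∣∧<2·⇒≡ {m = m} {d = d} 0<m d∣m@(y , dy≡m) m<2d = trans (sym dy≡m) (trans (cong (d ·_) y≡1) (A7 d))
    where
    y≡1 : y ≡ 1#
    y≡1 = ≤-antisym (<+1⇒≤ (·-cancelˡ-< (subst₂ _<_ (sym dy≡m) (A4 (num 2) d) m<2d)))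
                    (0<⇒1≤ (∣⇒0< 0<m (∣-quotient d∣m)))

  square-¬prime : 1# < x → ¬ Prime (x · x)
  square-¬prime {x = x} 1<x pxx = <⇒≱ (x<x·x 1<x) (∣⇒≤ (<-trans 0<1 1<x) xx∣x)
    where
    xx∣x : x · x ∣ x
    xx∣x = reduce (proj₂ pxx x x 1# (A7 (x · x)))

  prime-factor-of-product : Prime u → 1# < y → Σ M λ w → Prime w × w ∣ u · y × w · w ≤ u · y
  prime-factor-of-product {u = u} {y = y} pu 1<y with A20 y 1<y
  ... | v , pv , v∣y with ≤∨> u v | ∣⇒≤ (<-trans 0<1 1<y) v∣y
  ... | inj₁ u≤v | v≤y = u , pu , (y , refl) , ·-monoʳ-≤ (≤-trans u≤v v≤y)
  ... | inj₂ v<u | v≤y = v , pv , ∣-trans v∣y n∣m·n , ·-mono-≤ (inj₁ v<u) v≤y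

  composite⇒prime-factor : 1# < t → ¬ Prime t → Σ M λ w → Prime w × w ∣ t × w · w ≤ t
  composite⇒prime-factor 1<t ¬pt with A20 _ 1<t
  ... | u , pu , (y , refl) with 0<⇒1≤ (∣⇒0< (<-trans 0<1 1<t) (n∣m·n {u} {y}))
  ... | inj₁ 1<y = prime-factor-of-product pu 1<y
  ... | inj₂ refl = ⊥-elim (¬pt (subst Prime (sym (A7 u)) pu))

  noCommonPrime⇒relPrime : 0# < y → (∀ u → Prime u → u ∣ x → u ∣ y → ⊥) → RelPrime x y
  noCommonPrime⇒relPrime 0<y noCommonPrime d d∣x d∣y with ≤∨> d 1#
  ... | inj₁ d≤1 = ≤-antisym d≤1 (0<⇒1≤ (∣⇒0< 0<y d∣y))
  ... | inj₂ 1<d with A20 d 1<d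
  ... | u , pu , u∣d = ⊥-elim (noCommonPrime u pu (∣-trans u∣d d∣x) (∣-trans u∣d d∣y))

  Saturated : M → M → Set
  Saturated p n = ∀ w → Prime w → p < w → w · w < n → w ∣ n

  LargestSaturated : M → Set
  LargestSaturated p = Σ M λ n → Saturated p n × (∀ m → n < m → ¬ Saturated p m)

  Counterexample : M → M → Set
  Counterexample p m = Σ M λ q → (1# < q) × (q < m) × RelPrime q m
                                × (∀ u → Prime u → u ≤ p → RelPrime u q) × ¬ Prime q

  saturated⇒good : LEM → Saturated p n → Good p n
  saturated⇒good {p = p} lem sat t 1<t t<n t⊥n smallPrimes⊥t with lem (Prime t)
  ... | inj₁ pt = pt
  ... | inj₂ ¬pt with composite⇒prime-factor 1<t ¬pt
  ... | w , pw , w∣t , ww≤t with ≤∨> w p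
  ... | inj₁ w≤p = ⊥-elim (prime≢1 pw (smallPrimes⊥t w pw w≤p w ∣-refl w∣t))
  ... | inj₂ p<w = ⊥-elim (prime≢1 pw (t⊥n w w∣t (sat w pw p<w (≤-<-trans ww≤t t<n))))

  ¬saturated⇒witness : LEM → ¬ Saturated p m → Σ M λ w → Prime w × p < w × w · w < m × ¬ w ∣ m
  ¬saturated⇒witness lem ¬sat = stable lem _ λ ¬∃ →
    ¬sat λ w pw p<w ww<m → stable lem _ λ w∤m → ¬∃ (w , pw , p<w , ww<m , w∤m)

  ¬saturated⇒counterexample : LEM → 0# < m → ¬ Saturated p m → Counterexample p m
  ¬saturated⇒counterexample {m = m} {p = p} lem 0<m ¬sat with ¬saturated⇒witness lem ¬sat
  ... | w , pw , p<w , ww<m , w∤m =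
    w · w , 1<ww , ww<m , ww⊥m , smallPrimes⊥ww , square-¬prime (prime⇒1< pw)
    where
    1<ww : 1# < w · w
    1<ww = <-trans (prime⇒1< pw) (x<x·x (prime⇒1< pw))
    ww⊥m : RelPrime (w · w) m
    ww⊥m = noCommonPrime⇒relPrime 0<m λ u pu u∣ww u∣m →
      w∤m (subst (_∣ m) (reduce (prime∣·⇒≡ pu pw pw u∣ww)) u∣m)
    smallPrimes⊥ww : ∀ u → Prime u → u ≤ p → RelPrime u (w · w)
    smallPrimes⊥ww u pu u≤p = noCommonPrime⇒relPrime (<-trans 0<1 1<ww) λ v pv v∣u v∣ww →
      <⇒≢ (≤-<-trans u≤p p<w)
          (trans (sym (prime∣prime⇒≡ pv pu v∣u)) (reduce (prime∣·⇒≡ pv pw pw v∣ww)))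

  successor : Prime p → Σ M (Consecutive p)
  successor pp = map₂ (pp ,_) (A16 _ pp)

  predecessor : Prime p → num 2 < p → Σ M λ r → Consecutive r p
  predecessor {p = p} pp 2<p with A17 p pp 2<p
  ... | r , pr , r<p , r-max = r , pr , pp , r<p , p-min
    where
    p-min : ∀ u → Prime u → r < u → p ≤ u
    p-min u pu r<u with ≤∨> p u
    ... | inj₁ p≤u = p≤u
    ... | inj₂ u<p = ⊥-elim (<⇒≱ r<u (r-max u pu u<p))

  consecutive-<⇒≤ : Consecutive r q → Prime u → u < q → u ≤ r
  consecutive-<⇒≤ {r = r} {u = u} (_ , _ , _ , q-min) pu u<q with ≤∨> u r
  ... | inj₁ u≤r = u≤r
  ... | inj₂ r<u = ⊥-elim (<⇒≱ u<q (q-min u pu r<u))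

  consecutive-product : Consecutive r p → Consecutive p q → num 17 < q → 0# < m → m ≤ q · q →
                        p ∣ m → r ∣ m → m ≡ p · r
  consecutive-product {r = r} {p = p} {q = q} {m = m}
    crp@(pr , pp , r<p , _) cpq@(_ , pq , p<q , _) 17<q 0<m m≤qq p∣m r∣m =
    ∣∧<2·⇒≡ 0<m (distinct-primes⇒·∣ pp pr (<⇒≢ r<p ∘ sym) p∣m r∣m) m<2pr
    where
    m<2pr : m < num 2 · (p · r)
    m<2pr = subst (m <_) (A3 (num 2) p r) (≤-<-trans m≤qq (A19 r p q pr pp pq r<p p<q crp cpq 17<q))

  saturated-consecutive-product⇒≤ : Consecutive p p₁ → Consecutive r q → Saturated p (q · r) → r ≤ p₁
  saturated-consecutive-product⇒≤ {p₁ = p₁} {r = r} {q = q} (pp , pp₁ , p<p₁ , _) (pr , pq , r<q , _) sat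
    with ≤∨> r p₁
  ... | inj₁ r≤p₁ = r≤p₁
  ... | inj₂ p₁<r with predecessor pr (≤-<-trans (prime⇒2≤ pp) (<-trans p<p₁ p₁<r))
  ... | s , csr@(ps , _ , s<r , _) =
    ⊥-elim ([ <⇒≢ (<-trans s<r r<q) , <⇒≢ s<r ]′ (prime∣·⇒≡ ps pq pr s∣qr))
    where
    s∣qr : s ∣ q · r
    s∣qr = sat s ps (<-≤-trans p<p₁ (consecutive-<⇒≤ csr pp₁ p₁<r))
                    (<-≤-trans (square-< s<r) (·-monoˡ-≤ (inj₁ r<q)))

  saturated-window : Consecutive p p₁ → Consecutive p₁ p₂ → Saturated p m → Consecutive r q →
                     p₂ ≤ r → num 17 < q → r · r < m → m ≤ q · q → m ≤ p₂ · p₂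
  saturated-window {p = p} {p₁ = p₁} {p₂ = p₂} {m = m} {r = P}
    cpp₁@(pp , pp₁ , p<p₁ , _) (_ , pp₂ , p₁<p₂ , _) sat cPQ@(pP , _) p₂≤P 17<Q PP<m m≤QQ
    with predecessor pP (≤-<-trans (prime⇒2≤ pp) (<-≤-trans (<-trans p<p₁ p₁<p₂) p₂≤P))
  ... | R , cRP@(pR , _ , R<P , P-min) =
    subst (_≤ p₂ · p₂) (sym m≡PR) (·-mono-≤ P≤p₂ (≤-trans R≤p₁ (inj₁ p₁<p₂)))
    where
    p<R : p < R
    p<R = <-≤-trans p<p₁ (consecutive-<⇒≤ cRP pp₁ (<-≤-trans p₁<p₂ p₂≤P))
    m≡PR : m ≡ P · R
    m≡PR = consecutive-product cRP cPQ 17<Q (≤-<-trans 0≤ PP<m) m≤QQ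
             (sat P pP (<-trans p<R R<P) PP<m) (sat R pR p<R (<-trans (square-< R<P) PP<m))
    R≤p₁ : R ≤ p₁
    R≤p₁ = saturated-consecutive-product⇒≤ cpp₁ cRP (subst (Saturated _) m≡PR sat)
    P≤p₂ : P ≤ p₂
    P≤p₂ = P-min p₂ pp₂ (≤-<-trans R≤p₁ p₁<p₂)

  saturated-bound : Consecutive p p₁ → Consecutive p₁ p₂ → Saturated p m → num 4 < m →
                    m ≤ p₂ · p₂ ⊎ (p < num 17 × m ≤ num 17 · num 17)
  saturated-bound {p₂ = p₂} {m = m} cpp₁@(_ , _ , p<p₁ , _) cp₁p₂@(_ , pp₂ , p₁<p₂ , _) sat 4<m
    with A18 m 4<m
  ... | P , pP , PP<m , P-largest with successor pP
  ... | Q , cPQ@(_ , pQ , P<Q , _) with ≤∨> p₂ P | ≤∨> Q (num 17)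
  ... | inj₂ P<p₂ | _ = inj₁ (P-largest p₂ pp₂ P<p₂)
  ... | inj₁ p₂≤P | inj₁ Q≤17 =
    inj₂ ( <-≤-trans (<-trans (<-trans p<p₁ p₁<p₂) (≤-<-trans p₂≤P P<Q)) Q≤17
         , ≤-trans (P-largest Q pQ P<Q) (square-≤ Q≤17))
  ... | inj₁ p₂≤P | inj₂ 17<Q =
    inj₁ (saturated-window cpp₁ cp₁p₂ sat cPQ p₂≤P 17<Q PP<m (P-largest Q pQ P<Q))

  num-suc : ∀ k → num (suc k) ≡ num k + 1#
  num-suc zero = sym (+-identityˡ 1#)
  num-suc (suc k) = refl

  num-+ : ∀ a b → num (a ℕ.+ b) ≡ num a + num b
  num-+ a zero = trans (cong num (ℕₚ.+-identityʳ a)) (sym (+-identityʳ (num a)))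
  num-+ a (suc b) = begin
    num (a ℕ.+ suc b)        ≡⟨ cong num (ℕₚ.+-suc a b) ⟩
    num (suc (a ℕ.+ b))      ≡⟨ num-suc (a ℕ.+ b) ⟩
    num (a ℕ.+ b) + 1#       ≡⟨ cong (_+ 1#) (num-+ a b) ⟩
    (num a + num b) + 1#     ≡⟨ A1 (num a) (num b) 1# ⟩
    num a + (num b + 1#)     ≡⟨ cong (num a +_) (sym (num-suc b)) ⟩
    num a + num (suc b)      ∎
    where open ≡-Reasoning

  num-* : ∀ a b → num (a ℕ.* b) ≡ num a · num b
  num-* a zero = trans (cong num (ℕₚ.*-zeroʳ a)) (sym (zeroʳ (num a)))
  num-* a (suc b) = begin
    num (a ℕ.* suc b)            ≡⟨ cong num (trans (ℕₚ.*-suc a b) (ℕₚ.+-comm a (a ℕ.* b))) ⟩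
    num (a ℕ.* b ℕ.+ a)          ≡⟨ num-+ (a ℕ.* b) a ⟩
    num (a ℕ.* b) + num a        ≡⟨ cong₂ _+_ (num-* a b) (sym (A7 (num a))) ⟩
    num a · num b + num a · 1#   ≡⟨ sym (A5 (num a) (num b) 1#) ⟩
    num a · (num b + 1#)         ≡⟨ cong (num a ·_) (sym (num-suc b)) ⟩
    num a · num (suc b)          ∎
    where open ≡-Reasoning

  num-mono-< : ∀ {a b} → a ℕ.< b → num a < num b
  num-mono-< {a} {suc b} (s≤s a≤b) with ℕₚ.m≤n⇒m<n∨m≡n a≤b
  ... | inj₁ a<b = <-trans (num-mono-< a<b) (subst (num b <_) (sym (num-suc b)) x<x+1)
  ... | inj₂ refl = subst (num a <_) (sym (num-suc a)) x<x+1

  num-mono-≤ : ∀ {a b} → a ℕ.≤ b → num a ≤ num b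
  num-mono-≤ a≤b = [ inj₁ ∘ num-mono-< , (λ { refl → ≤-refl }) ]′ (ℕₚ.m≤n⇒m<n∨m≡n a≤b)

  num-cancel-< : ∀ {a b} → num a < num b → a ℕ.< b
  num-cancel-< a<b = ℕₚ.≰⇒> (<⇒≱ a<b ∘ num-mono-≤)

  num-injective : ∀ {a b} → num a ≡ num b → a ≡ b
  num-injective a≡b = ℕₚ.≤-antisym (ℕₚ.≮⇒≥ λ b<a → <⇒≢ (num-mono-< b<a) (sym a≡b))
                                   (ℕₚ.≮⇒≥ λ a<b → <⇒≢ (num-mono-< a<b) a≡b)

  <-numeral : ∀ k → x < num k → Σ ℕ λ j → j ℕ.< k × x ≡ num j
  <-numeral zero x<0 = ⊥-elim (<⇒≱ x<0 0≤)
  <-numeral (suc k) x<k+1 with <+1⇒≤ (subst (_ <_) (num-suc k) x<k+1)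
  ... | inj₂ x≡k = k , ℕₚ.n<1+n k , x≡k
  ... | inj₁ x<k with <-numeral k x<k
  ...   | j , j<k , x≡j = j , ℕₚ.m<n⇒m<1+n j<k , x≡j

  num-∣ : ∀ {d a} → d ∣ℕ a → num d ∣ num a
  num-∣ {d} (divides q refl) = num q , trans (A4 (num d) (num q)) (sym (num-* q d))

  ≤-numeral : ∀ k → x ≤ num k → Σ ℕ λ j → x ≡ num j
  ≤-numeral k x≤k = map₂ proj₂ (<-numeral (suc k) (≤-<-trans x≤k (num-mono-< (ℕₚ.n<1+n k))))

  num-∣-reflect : ∀ {d a} → 0 ℕ.< a → num d ∣ num a → d ∣ℕ a
  num-∣-reflect {d} {a} 0<a d∣a@(z , dz≡a) with ≤-numeral a (∣⇒≤ (num-mono-< 0<a) (∣-quotient d∣a))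
  ... | c , refl = divides c (trans (num-injective (trans (sym dz≡a) (sym (num-* d c)))) (ℕₚ.*-comm d c))

  ∣-numeral : ∀ {a} → 0 ℕ.< a → x ∣ num a → Σ ℕ λ j → x ≡ num j × j ∣ℕ a
  ∣-numeral {a = a} 0<a x∣a with ≤-numeral a (∣⇒≤ (num-mono-< 0<a) x∣a)
  ... | j , refl = j , refl , num-∣-reflect 0<a x∣a

  num-prime : ∀ {a} → Primeℕ a → Prime (num a)
  num-prime {a} pa = primeDivisor⇒prime (A20 (num a) (num-mono-< 1<a))
    where
    1<a : 1 ℕ.< a
    1<a = ℕ.nonTrivial⇒n>1 a {{prime⇒nonTrivial pa}}
    primeDivisor⇒prime : Σ M (λ u → Prime u × u ∣ num a) → Prime (num a)
    primeDivisor⇒prime (u , pu , u∣a) with ∣-numeral (ℕₚ.<⇒≤ 1<a) u∣a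
    ... | j , refl , j∣a with prime⇒irreducible pa j∣a
    ... | inj₁ refl = ⊥-elim (prime≢1 pu refl)
    ... | inj₂ refl = pu

  num-prime-reflect : ∀ {a} → Prime (num a) → Primeℕ a
  num-prime-reflect {a} pa = irreducible⇒prime {{ℕ.n>1⇒nonTrivial (num-cancel-< (prime⇒1< pa))}} irreducible
    where
    irreducible : Irreducible a
    irreducible d∣a = ⊎-map num-injective num-injective (prime-divisors pa (num-∣ d∣a))

  saturated⇒saturatedBelow : ∀ {b i n} → 0 ℕ.< n → Saturated (num i) (num n) → SaturatedBelow b i n
  saturated⇒saturatedBelow {n = n} 0<n sat {w} _ pw i<w ww<n = num-∣-reflect 0<n
    (sat (num w) (num-prime pw) (num-mono-< i<w) (subst (_< num n) (num-* w w) (num-mono-< ww<n)))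

  saturatedBelow⇒saturated : ∀ {b i n} → n ℕ.≤ b ℕ.* b → SaturatedBelow b i n → Saturated (num i) (num n)
  saturatedBelow⇒saturated {b} {i} {n} n≤bb sat w pw i<w ww<n
    with <-numeral b (square-cancel-< (<-≤-trans ww<n (subst (num n ≤_) (num-* b b) (num-mono-≤ n≤bb))))
  ... | d , d<b , refl = num-∣ (sat d<b (num-prime-reflect pw) (num-cancel-< i<w)
                                   (num-cancel-< (subst (_< num n) (sym (num-* d d)) ww<n)))

  saturated-small-bound : Prime p → p < num 19 → Saturated p m → num 4 < m → m ≤ num 23 · num 23
  saturated-small-bound pp p<19 sat 4<m with successor pp
  ... | p₁ , cpp₁@(_ , pp₁ , _ , p₁-min) with successor pp₁
  ... | p₂ , cp₁p₂@(_ , _ , _ , p₂-min) with saturated-bound cpp₁ cp₁p₂ sat 4<m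
  ... | inj₁ m≤p₂p₂ = ≤-trans m≤p₂p₂ (square-≤ p₂≤23)
    where
    p₁<23 : p₁ < num 23
    p₁<23 = ≤-<-trans (p₁-min (num 19) (num-prime (from-yes (prime? 19))) p<19) (num-mono-< (from-yes (19 ℕ.<? 23)))
    p₂≤23 : p₂ ≤ num 23
    p₂≤23 = p₂-min (num 23) (num-prime (from-yes (prime? 23))) p₁<23
  ... | inj₂ (_ , m≤17²) = ≤-trans m≤17² (square-≤ (inj₁ (num-mono-< (from-yes (17 ℕ.<? 23)))))

  largestSaturated-small : Prime p → p < num 18 → LargestSaturated p
  largestSaturated-small pp p<18 with <-numeral 18 p<18
  ... | i , i<18 , refl with largestGood-saturated i<18 (num-prime-reflect pp)
  ... | 4<n , n<530 , n-saturated =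
    num (largestGood i) , saturatedBelow⇒saturated (ℕₚ.≤-pred n<530) n-saturated , maximal
    where
    maximal : ∀ m → num (largestGood i) < m → ¬ Saturated (num i) m
    maximal m n<m sat = numeral-unsaturated (<-numeral 530 m<530)
      where
      m<530 : m < num 530
      m<530 = ≤-<-trans (subst (m ≤_) (sym (num-* 23 23))
        (saturated-small-bound pp (<-trans p<18 x<x+1) sat (<-trans (num-mono-< 4<n) n<m))) x<x+1
      numeral-unsaturated : (Σ ℕ λ j → j ℕ.< 530 × m ≡ num j) → ⊥
      numeral-unsaturated (j , j<530 , refl) = above-largestGood-unsaturated i<18 (num-prime-reflect pp) j<530 n<j
        (saturated⇒saturatedBelow (ℕₚ.≤-<-trans z≤n n<j) sat)
        where
        n<j : largestGood i ℕ.< j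
        n<j = num-cancel-< n<m

  largestSaturated-large : Prime p → num 17 < p → LargestSaturated p
  largestSaturated-large {p = p} pp 17<p with successor pp
  ... | p₁ , cpp₁@(_ , pp₁ , p<p₁ , p₁-min) with successor pp₁
  ... | p₂ , cp₁p₂@(_ , pp₂ , p₁<p₂ , p₂-min) with A21 p₁ p₂ cp₁p₂
  ... | k , kp₁<p₂p₂ , p₂p₂<[k+1]p₁ = k · p₁ , saturated , maximal
    where
    saturated : Saturated p (k · p₁)
    saturated w pw p<w ww<n with ≤∨> w p₁
    ... | inj₁ w≤p₁ = subst (_∣ k · p₁) (≤-antisym (p₁-min w pw p<w) w≤p₁) n∣m·n
    ... | inj₂ p₁<w = ⊥-elim (<⇒≱ (<-trans ww<n kp₁<p₂p₂) (square-≤ (p₂-min w pw p₁<w)))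

    p₁≤k : p₁ ≤ k
    p₁≤k = ≤-trans (inj₁ p₁<p₂)
             (<+1⇒≤ (·-cancelʳ-< (≤-<-trans (·-monoʳ-≤ (inj₁ p₁<p₂)) p₂p₂<[k+1]p₁)))

    p₁p₁≤n : p₁ · p₁ ≤ k · p₁
    p₁p₁≤n = ·-monoˡ-≤ p₁≤k

    4<n : num 4 < k · p₁
    4<n = <-trans (num-mono-< (from-yes (4 ℕ.<? 17)))
            (<-trans 17<p (<-trans p<p₁ (<-≤-trans (x<x·x (prime⇒1< pp₁)) p₁p₁≤n)))

    maximal : ∀ m → k · p₁ < m → ¬ Saturated p m
    maximal m n<m sat with saturated-bound cpp₁ cp₁p₂ sat (<-trans 4<n n<m)
    ... | inj₂ (p<17 , _) = <⇒≱ p<17 (inj₁ 17<p)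
    ... | inj₁ m≤p₂p₂ with sat p₁ pp₁ p<p₁ (≤-<-trans p₁p₁≤n n<m)
    ... | j , p₁j≡m = <⇒≱ n<m (subst (_≤ k · p₁) jp₁≡m (·-monoˡ-≤ j≤k))
      where
      jp₁≡m : j · p₁ ≡ m
      jp₁≡m = trans (A4 j p₁) p₁j≡m
      j≤k : j ≤ k
      j≤k = <+1⇒≤ (·-cancelʳ-<
              (≤-<-trans (subst (_≤ p₂ · p₂) (sym jp₁≡m) m≤p₂p₂) p₂p₂<[k+1]p₁))

  largestSaturated : Prime p → LargestSaturated p
  largestSaturated {p = p} pp with ≤∨> p (num 17)
  ... | inj₁ p≤17 = largestSaturated-small pp (≤-<-trans p≤17 x<x+1)
  ... | inj₂ 17<p = largestSaturated-large pp 17<p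

theorem4p2 : LEM → (S : Structure) → IsΣ' S → Notions.GSs S
theorem4p2 lem S ax p pp =
  let open Model S ax
      (n , n-saturated , n-maximal) = largestSaturated pp
  in n , saturated⇒good lem n-saturated ,
     λ m n<m → ¬saturated⇒counterexample lem (≤-<-trans 0≤ n<m) (n-maximal m n<m)
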